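{- Let $s_0,s_1\in\mathbb{R}$ and $k\in\mathbb{N}_0$. Then for every $a\in\{0,1,\dots,2^k-1\}$, writing $a=\sum_{i=1}^k\sigma_i2^{k-i}$ with $\sigma_i\in\{0,1\}$, we have $\hat c_k(a)=c_k(\sigma_1,\dots,\sigma_k)$.
   Context: For $k\in\mathbb{N}$ let $\mathbb{G}_k=(\mathbb{Z}/2\mathbb{Z})^k$ (elements $\sigma=(\sigma_1,\dots,\sigma_k)$, $\sigma_i\in\{0,1\}$), and for $\sigma\in\mathbb{G}_k$ let $1-\sigma:=(1-\sigma_1,\dots,1-\sigma_k)$. For $s_0,s_1\in\mathbb{R}$ define $\xi_k(s_0,s_1):\mathbb{G}_k\to\mathbb{R}$ by $\xi_1(s_0,s_1)(0)=s_0$, $\xi_1(s_0,s_1)(1)=s_1$, and $\xi_{k+1}(s_0,s_1)(\sigma,\sigma_{k+1})=\xi_k(s_0,s_1)(\sigma)+\sigma_{k+1}\,\xi_k(s_0,s_1)(1-\sigma)$ for $\sigma\in\mathbb{G}_k$, $\sigma_{k+1}\in\{0,1\}$. For $k\in\mathbb{N}_0$ define $c_k:\mathbb{G}_k\to\mathbb{R}$ by $c_k(\sigma)=\xi_{k+1}(s_0,s_1)(0,\sigma)$ (for $k=0$, $c_0=\xi_1(s_0,s_1)(0)=s_0$). Define $\hat c_k:\{0,\dots,2^k\}\to\mathbb{R}$ by $\hat c_0(0)=s_0$, $\hat c_0(1)=s_1$, $\hat c_{k+1}(2s)=\hat c_k(s)$ for $s\in\{0,\dots,2^k\}$ and $\hat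 c_{k+1}(2s+1)=\hat c_k(s)+\hat c_k(s+1)$ for $s\in\{0,\dots,2^k-1\}$. -}

module Defs where

open import Level using (Level)
open import Algebra.Bundles using (CommutativeMonoid)
open import Data.Bool using (Bool; true; false; if_then_else_; not)
open import Data.Nat using (ℕ; zero; suc; _+_; _^_)
open import Data.Nat.DivMod using (_/_; _%_)
open import Data.Vec using (Vec; []; _∷_; init; last; map)

-- The values s₀, s₁ live in an arbitrary commutative monoid (written additively);
-- ℝ under + is an instance.  Only addition and the neutral element (for σ·x with σ = 0)
-- are used by the definitions.
module Construction {a ℓ : Level} (M : CommutativeMonoid a ℓ)
                    (s₀ s₁ : CommutativeMonoid.Carrier M) where
  open CommutativeMonoid M renaming (_∙_ to _⊕_; ε to 𝟘)

  -- 𝔾ₖ = (ℤ/2)^k, σ = (σ₁,…,σₖ) as a vector of bits (true = 1), σ₁ first.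
  G : ℕ → Set
  G k = Vec Bool k

  flip : ∀ {k} → G k → G k
  flip = map not

  scale : Bool → Carrier → Carrier
  scale b x = if b then x else 𝟘

  -- ξₖ(s₀,s₁) : 𝔾ₖ → M, defined for k ≥ 1 (index shifted: ξ k = ξ_{k+1}).
  -- ξ_{k+1}(σ, σ_{k+1}) = ξ_k(σ) + σ_{k+1} ξ_k(1-σ), σ_{k+1} being the LAST coordinate.
  ξ : (k : ℕ) → G (suc k) → Carrier
  ξ zero (false ∷ []) = s₀
  ξ zero (true ∷ [])  = s₁
  ξ (suc k) v = ξ k (init v) ⊕ scale (last v) (ξ k (flip (init v)))

  c : (k : ℕ) → G k → Carrier
  c k σ = ξ k (false ∷ σ)

  -- ĉₖ : {0,…,2^k} → M, represented as a function on ℕ; values outside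
  -- {0,…,2^k} are junk (𝟘 at level 0) and never used by the statement.
  ĉ : ℕ → ℕ → Carrier
  ĉ zero zero = s₀
  ĉ zero (suc zero) = s₁
  ĉ zero (suc (suc _)) = 𝟘
  ĉ (suc k) n with n % 2
  ... | zero  = ĉ k (n / 2)
  ... | suc _ = ĉ k (n / 2) ⊕ ĉ k (suc (n / 2))

bin : ∀ {k} → Vec Bool k → ℕ
bin [] = 0
bin {suc k} (b ∷ v) = (if b then 2 ^ k else 0) + bin v

{-# OPTIONS --safe #-}
-- Extend the claim from c = ξ(0,·) to all of ξ: the string (1,σ) sits at the mirror
-- position 2^k − bin σ = 1 + bin (1 − σ).  Appending a last bit 0 to τ doubles its
-- position, while appending a 1 lands strictly between the positions of τ and 1 − τ,
-- which are neighbours; so the recursion of ξ in its last bit is exactly the parity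
-- recursion of ĉ.
module Submission where

open import Defs
open import Level using (Level)
open import Algebra.Bundles using (CommutativeMonoid)
open import Data.Bool using (Bool; true; false; not)
open import Data.Bool.Properties using (not-involutive)
open import Data.Nat using (ℕ; zero; suc; _+_; _*_; _^_; _<_)
open import Data.Nat.DivMod using (_/_; m*n%n≡0; m*n/n≡m; [m+kn]%n≡m%n; +-distrib-/-∣ʳ)
open import Data.Nat.Divisibility using (n∣m*n)
open import Data.Nat.Solver using (module +-*-Solver)
open import Data.Product using (_,_)
open import Function using (_∘_)
open import Data.Vec using (Vec; []; _∷_; _∷ʳ_; map; initLast)
open import Data.Vec.Properties using (map-∷ʳ; map-∘; map-cong; map-id)
open import Relation.Binary.PropositionalEquality
  using (_≡_; refl; cong; trans; module ≡-Reasoning)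
import Relation.Binary.Reasoning.Setoid as SetoidReasoning

map-not-involutive : ∀ {k} (σ : Vec Bool k) → map not (map not σ) ≡ σ
map-not-involutive σ = begin
  map not (map not σ)       ≡⟨ map-∘ not not σ ⟨
  map (λ b → not (not b)) σ ≡⟨ map-cong not-involutive σ ⟩
  map (λ b → b) σ           ≡⟨ map-id σ ⟩
  σ                         ∎
  where open ≡-Reasoning

bit : Bool → ℕ
bit false = 0
bit true  = 1

bin-∷ʳ : ∀ {k} (σ : Vec Bool k) b → bin (σ ∷ʳ b) ≡ bit b + bin σ * 2
bin-∷ʳ [] false = refl
bin-∷ʳ [] true  = refl
bin-∷ʳ {suc k} (false ∷ σ) b = bin-∷ʳ σ b
bin-∷ʳ {suc k} (true ∷ σ) b = begin
  2 ^ suc k + bin (σ ∷ʳ b)        ≡⟨ cong (2 ^ suc k +_) (bin-∷ʳ σ b) ⟩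
  2 ^ suc k + (bit b + bin σ * 2) ≡⟨ shift (2 ^ k) (bit b) (bin σ) ⟩
  bit b + (2 ^ k + bin σ) * 2     ∎
  where
  open ≡-Reasoning
  open +-*-Solver using (solve; _:=_; _:+_; _:*_; con)
  shift : ∀ p x r → 2 * p + (x + r * 2) ≡ x + (p + r) * 2
  shift = solve 3 (λ p x r → con 2 :* p :+ (x :+ r :* con 2) := x :+ (p :+ r) :* con 2) refl

bin-map-not-∷ʳ : ∀ {k} (σ : Vec Bool k) b → bin (map not (σ ∷ʳ b)) ≡ bit (not b) + bin (map not σ) * 2
bin-map-not-∷ʳ σ b = trans (cong bin (map-∷ʳ not b σ)) (bin-∷ʳ (map not σ) (not b))

[1+n*2]/2≡n : ∀ n → (1 + n * 2) / 2 ≡ n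
[1+n*2]/2≡n n = trans (+-distrib-/-∣ʳ 1 {d = 2} (n∣m*n n)) (m*n/n≡m n 2)

index : ∀ {k} → Vec Bool (suc k) → ℕ
index (false ∷ σ) = bin σ
index (true ∷ σ)  = suc (bin (map not σ))

index-∷ʳ-false : ∀ {k} (τ : Vec Bool (suc k)) → index (τ ∷ʳ false) ≡ index τ * 2
index-∷ʳ-false (false ∷ σ) = bin-∷ʳ σ false
index-∷ʳ-false (true ∷ σ)  = cong suc (bin-map-not-∷ʳ σ false)

index-map-not-false∷ : ∀ {k} (σ : Vec Bool k) → index (map not (false ∷ σ)) ≡ suc (index (false ∷ σ))
index-map-not-false∷ σ = cong (suc ∘ bin) (map-not-involutive σ)

module _ {a ℓ : Level} (M : CommutativeMonoid a ℓ) (s₀ s₁ : CommutativeMonoid.Carrier M) where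
  open CommutativeMonoid M
    using (_≈_; setoid; identityʳ; ∙-cong; comm) renaming (_∙_ to _⊕_; ε to 𝟘; refl to ≈-refl)
  open Construction M s₀ s₁

  ĉ-double : ∀ k n → ĉ (suc k) (n * 2) ≡ ĉ k n
  ĉ-double k n rewrite m*n%n≡0 n 2 ⦃ _ ⦄ | m*n/n≡m n 2 ⦃ _ ⦄ = refl

  ĉ-double-suc : ∀ k n → ĉ (suc k) (1 + n * 2) ≡ ĉ k n ⊕ ĉ k (suc n)
  ĉ-double-suc k n rewrite [m+kn]%n≡m%n 1 n 2 ⦃ _ ⦄ | [1+n*2]/2≡n n = refl

  ĉ-index : ∀ k (τ : Vec Bool (suc k)) → ĉ k (index τ) ≈ ξ k τ
  ĉ-index zero (false ∷ []) = ≈-refl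
  ĉ-index zero (true ∷ [])  = ≈-refl
  ĉ-index (suc k) τ with initLast τ
  ... | ρ , false , refl = begin
    ĉ (suc k) (index (ρ ∷ʳ false)) ≡⟨ cong (ĉ (suc k)) (index-∷ʳ-false ρ) ⟩
    ĉ (suc k) (index ρ * 2)        ≡⟨ ĉ-double k (index ρ) ⟩
    ĉ k (index ρ)                  ≈⟨ ĉ-index k ρ ⟩
    ξ k ρ                          ≈⟨ identityʳ (ξ k ρ) ⟨
    ξ k ρ ⊕ 𝟘                      ∎
    where open SetoidReasoning setoid
  ... | false ∷ σ , true , refl = begin
    ĉ (suc k) (bin (σ ∷ʳ true))      ≡⟨ cong (ĉ (suc k)) (bin-∷ʳ σ true) ⟩
    ĉ (suc k) (1 + bin σ * 2)        ≡⟨ ĉ-double-suc k (bin σ) ⟩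
    ĉ k (bin σ) ⊕ ĉ k (suc (bin σ))  ≡⟨ cong (λ i → ĉ k (bin σ) ⊕ ĉ k i) (index-map-not-false∷ σ) ⟨
    ĉ k (bin σ) ⊕ ĉ k (index (true ∷ map not σ))
      ≈⟨ ∙-cong (ĉ-index k (false ∷ σ)) (ĉ-index k (true ∷ map not σ)) ⟩
    ξ k (false ∷ σ) ⊕ ξ k (true ∷ map not σ) ∎
    where open SetoidReasoning setoid
  ... | true ∷ σ , true , refl = begin
    ĉ (suc k) (suc (bin (map not (σ ∷ʳ true)))) ≡⟨ cong (ĉ (suc k) ∘ suc) (bin-map-not-∷ʳ σ true) ⟩
    ĉ (suc k) (1 + bin (map not σ) * 2)          ≡⟨ ĉ-double-suc k (bin (map not σ)) ⟩
    ĉ k (bin (map not σ)) ⊕ ĉ k (suc (bin (map not σ)))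
      ≈⟨ ∙-cong (ĉ-index k (false ∷ map not σ)) (ĉ-index k (true ∷ σ)) ⟩
    ξ k (false ∷ map not σ) ⊕ ξ k (true ∷ σ)    ≈⟨ comm _ _ ⟩
    ξ k (true ∷ σ) ⊕ ξ k (false ∷ map not σ)    ∎
    where open SetoidReasoning setoid

lemma2p1 : ∀ {a ℓ : Level} (M : CommutativeMonoid a ℓ) (s₀ s₁ : CommutativeMonoid.Carrier M)
    (k : ℕ) (n : ℕ) → n < 2 ^ k → (σ : Vec Bool k) → n ≡ bin σ →
    CommutativeMonoid._≈_ M (Construction.ĉ M s₀ s₁ k n) (Construction.c M s₀ s₁ k σ)
lemma2p1 M s₀ s₁ k n _ σ refl = ĉ-index M s₀ s₁ k (false ∷ σ)
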